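{- Let $k \geq 1$, $n \geq 2$, $\overline{\Delta} \geq 0$ be integers with $n \geq k$, and let $D$ be an $n$-vertex directed multigraph with $\overline{\Delta}(D) \leq \overline{\Delta}$. Then $D$ has $k$ distinct vertices each having at least $(n-k-\overline{\Delta})/2$ in-neighbours in $D$, and $k$ distinct vertices each having at least $(n-k-\overline{\Delta})/2$ out-neighbours in $D$.
   Context: A directed multigraph is a pair $(V,E)$ with $E$ a multiset of elements of $(V\times V)\setminus\{(v,v)\}$. In-/out-neighbours are counted as sets of vertices. $\overline{\Delta}(D)$ is the maximum over $v$ of the number of vertices $w\neq v$ with neither $(v,w)$ nor $(w,v)$ in $E(D)$. -}

module Defs where

open import Data.Nat using (ℕ; _≤_; _+_; _*_)
open import Data.Fin using (Fin)
open import Data.Product using (_×_; _,_; Σ)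
open import Data.List using (List; filter; length; allFin)
open import Data.List.Relation.Unary.All using (All)
open import Data.List.Relation.Unary.Any using (any?)
open import Data.List.Membership.Propositional using (_∈_)
open import Relation.Binary.PropositionalEquality using (_≡_; _≢_)
open import Relation.Nullary using (¬_; Dec)
open import Relation.Nullary.Decidable using (_×-dec_; ¬?)
open import Data.Fin.Properties using (_≟_)
open import Data.Product.Properties using (≡-dec)

-- A directed multigraph on vertex set Fin n: a multiset of non-loop ordered
-- pairs, represented as a list of arcs (order irrelevant, repetition allowed)
-- together with a proof that no arc is a loop.
record DiMultigraph (n : ℕ) : Set where
  field
    arcs    : List (Fin n × Fin n)
    noLoops : All (λ e → Data.Product.proj₁ e ≢ Data.Product.proj₂ e) arcs
open DiMultigraph public

arc? : ∀ {n} (D : DiMultigraph n) (u v : Fin n) → Dec ((u , v) ∈ arcs D)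
arc? D u v = any? (λ e → ≡-dec _≟_ _≟_ (u , v) e) (arcs D)

-- Set of in-neighbours of v: vertices u with (u , v) ∈ E(D), counted once.
inDeg : ∀ {n} → DiMultigraph n → Fin n → ℕ
inDeg D v = length (filter (λ u → arc? D u v) (allFin _))

-- Set of out-neighbours of v: vertices w with (v , w) ∈ E(D), counted once.
outDeg : ∀ {n} → DiMultigraph n → Fin n → ℕ
outDeg D v = length (filter (λ w → arc? D v w) (allFin _))

nonDeg : ∀ {n} → DiMultigraph n → Fin n → ℕ
nonDeg D v = length (filter (λ w → ¬? (w ≟ v) ×-dec (¬? (arc? D v w) ×-dec ¬? (arc? D w v))) (allFin _))

-- Δ̄(D) ≤ d  ⇔  every vertex has at most d non-neighbours.
MaxNonDegAtMost : ∀ {n} → DiMultigraph n → ℕ → Set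
MaxNonDegAtMost {n} D d = (v : Fin n) → nonDeg D v ≤ d

-- Greedily pick vertices v₁, v₂, … while keeping track of the set T of
-- vertices not yet picked, |T| = n − j after j picks. Every vertex u of T
-- other than v is an in-neighbour, an out-neighbour or a non-neighbour of v,
-- so |T| ≤ 1 + in_T(v) + out_T(v) + Δ̄ for every v. Summed over v ∈ T the
-- in- and out-degrees inside T both count the arcs inside T, so on average
-- over T we get |T| ≤ 1 + 2 in_T(v) + Δ̄, and some v ∈ T attains it. Picking
-- that v gives n = |T| + j ≤ 2 in(v) + (j + 1) + Δ̄. Out-degrees are
-- in-degrees of the reversed graph, which has the same non-neighbours.
module Submission where

open import Defs
open import Data.Bool using (Bool; true; false; not; _∧_)
open import Data.Bool.Properties using (∧-comm; ∧-identityʳ; ∧-zeroʳ)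
open import Data.Fin using (Fin; zero; suc)
open import Data.Fin.Properties using (_≟_)
open import Data.List using (filter; length; tabulate)
open import Data.Nat using (ℕ; zero; suc; _≤_; _<_; _+_; _*_; z≤n; s≤s; s≤s⁻¹; _<?_)
open import Data.Nat.Properties hiding (_≟_)
open import Algebra.Properties.Semiring.Sum +-*-semiring
  using (sum-syntax; sum-cong-≗; ∑-distrib-+; ∑-comm; *-distribˡ-sum; sum-replicate-zero)
open import Data.Nat.Tactic.RingSolver using (solve-∀)
open import Data.Product using (_×_; Σ; _,_; ∃-syntax)
open import Data.Vec.Functional using (_∷_)
open import Function using (_∘_; flip)
open import Function.Definitions using (Injective)
open import Relation.Binary.PropositionalEquality
  using (_≡_; _≢_; refl; sym; trans; cong; subst; subst₂; module ≡-Reasoning)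
open import Relation.Nullary using (does; yes; no; contradiction)
open import Relation.Nullary.Decidable using (dec-true)
open import Relation.Unary using (Pred; Decidable)

toℕ : Bool → ℕ
toℕ false = 0
toℕ true  = 1

count : ∀ {n} → (Fin n → Bool) → ℕ
count {n} P = ∑[ i < n ] toℕ (P i)

length-filter-tabulate : ∀ {a p} {A : Set a} {P : Pred A p} (P? : Decidable P) {n} (g : Fin n → A) →
  length (filter P? (tabulate g)) ≡ count (λ i → does (P? (g i)))
length-filter-tabulate P? {zero}  g = refl
length-filter-tabulate P? {suc n} g with does (P? (g zero))
... | true  = cong suc (length-filter-tabulate P? (g ∘ suc))
... | false = length-filter-tabulate P? (g ∘ suc)

count-all : ∀ n → count {n} (λ _ → true) ≡ n
count-all zero    = refl
count-all (suc n) = cong suc (count-all n)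

count-≟ : ∀ {n} (v : Fin n) → count (λ u → does (u ≟ v)) ≡ 1
count-≟ {suc n} zero    = cong suc (sum-replicate-zero n)
count-≟ {suc n} (suc v) = count-≟ v

count-remove : ∀ {n} (T : Fin n → Bool) {v} → T v ≡ true →
  count T ≡ 1 + count (λ u → T u ∧ not (does (u ≟ v)))
count-remove T {v} Tv = begin
  count T                                                                ≡⟨ sum-cong-≗ split ⟩
  ∑[ u < _ ] (toℕ (does (u ≟ v)) + toℕ (T u ∧ not (does (u ≟ v))))       ≡⟨ ∑-distrib-+ (λ u → toℕ (does (u ≟ v))) _ ⟩
  count (λ u → does (u ≟ v)) + count (λ u → T u ∧ not (does (u ≟ v)))   ≡⟨ cong (_+ count (λ u → T u ∧ not (does (u ≟ v)))) (count-≟ v) ⟩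
  1 + count (λ u → T u ∧ not (does (u ≟ v)))                             ∎
  where
  open ≡-Reasoning
  split : ∀ u → toℕ (T u) ≡ toℕ (does (u ≟ v)) + toℕ (T u ∧ not (does (u ≟ v)))
  split u with u ≟ v
  ... | yes refl rewrite Tv = refl
  ... | no _     rewrite ∧-identityʳ (T u) = refl

∑-mono-≤ : ∀ {n} {f g : Fin n → ℕ} → (∀ i → f i ≤ g i) → ∑[ i < n ] f i ≤ ∑[ i < n ] g i
∑-mono-≤ {zero}  f≤g = z≤n
∑-mono-≤ {suc n} f≤g = +-mono-≤ (f≤g zero) (∑-mono-≤ (f≤g ∘ suc))

∑<∑⇒∃< : ∀ {n} {f g : Fin n → ℕ} → ∑[ i < n ] f i < ∑[ i < n ] g i → ∃[ i ] f i < g i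
∑<∑⇒∃< {suc n} {f} {g} ∑f<∑g with ∑[ i < n ] f (suc i) <? ∑[ i < n ] g (suc i)
... | yes ∑f′<∑g′ = let i , fᵢ<gᵢ = ∑<∑⇒∃< {f = f ∘ suc} {g ∘ suc} ∑f′<∑g′ in suc i , fᵢ<gᵢ
... | no  ∑f′≮∑g′ = zero , +-cancelʳ-< _ _ _ (<-≤-trans ∑f<∑g (+-monoʳ-≤ (g zero) (≮⇒≥ ∑f′≮∑g′)))

∑-weighted<⇒∃< : ∀ {n} (T : Fin n → Bool) {f g : Fin n → ℕ} →
  ∑[ v < n ] (toℕ (T v) * f v) < ∑[ v < n ] (toℕ (T v) * g v) → ∃[ v ] T v ≡ true × f v < g v
∑-weighted<⇒∃< T {f} {g} lt with ∑<∑⇒∃< lt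
... | v , Tf<Tg with T v in Tv
...   | true  = v , Tv , subst₂ _<_ (*-identityˡ (f v)) (*-identityˡ (g v)) Tf<Tg

∷-injective : ∀ {a} {A : Set a} {j} {x : A} {f : Fin j → A} →
  Injective _≡_ _≡_ f → (∀ i → f i ≢ x) → Injective _≡_ _≡_ (x ∷ f)
∷-injective f-inj x∉f {zero}  {zero}  _   = refl
∷-injective f-inj x∉f {zero}  {suc j} x≡f = contradiction (sym x≡f) (x∉f j)
∷-injective f-inj x∉f {suc i} {zero}  f≡x = contradiction f≡x (x∉f i)
∷-injective f-inj x∉f {suc i} {suc j} f≡f = cong suc (f-inj f≡f)

module _ {n : ℕ} (E : Fin n → Fin n → Bool) where

  inDegree : Fin n → ℕ
  inDegree v = count λ u → E u v

  inDegreeWithin outDegreeWithin : (Fin n → Bool) → Fin n → ℕ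
  inDegreeWithin  T v = count λ u → T u ∧ E u v
  outDegreeWithin T v = count λ u → T u ∧ E v u

  nonAdjacent : Fin n → Fin n → Bool
  nonAdjacent v u = not (does (u ≟ v)) ∧ (not (E v u) ∧ not (E u v))

  inDegreeWithin≤inDegree : ∀ T v → inDegreeWithin T v ≤ inDegree v
  inDegreeWithin≤inDegree T v = ∑-mono-≤ λ u → ∧-≤ (T u) (E u v)
    where
    ∧-≤ : ∀ a b → toℕ (a ∧ b) ≤ toℕ b
    ∧-≤ false b = z≤n
    ∧-≤ true  b = ≤-refl

  count≤1+in+out+nonAdjacent : ∀ T v →
    count T ≤ 1 + inDegreeWithin T v + outDegreeWithin T v + count (nonAdjacent v)
  count≤1+in+out+nonAdjacent T v = begin
    count T
      ≤⟨ ∑-mono-≤ (λ u → covered (T u) (does (u ≟ v)) (E u v) (E v u)) ⟩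
    ∑[ u < n ] (e u + i u + o u + toℕ (nonAdjacent v u))
      ≡⟨ ∑-distrib-+ (λ u → e u + i u + o u) _ ⟩
    ∑[ u < n ] (e u + i u + o u) + count (nonAdjacent v)
      ≡⟨ cong (_+ count (nonAdjacent v)) (∑-distrib-+ (λ u → e u + i u) o) ⟩
    ∑[ u < n ] (e u + i u) + outDegreeWithin T v + count (nonAdjacent v)
      ≡⟨ cong (λ s → s + outDegreeWithin T v + count (nonAdjacent v)) (∑-distrib-+ e i) ⟩
    count (λ u → does (u ≟ v)) + inDegreeWithin T v + outDegreeWithin T v + count (nonAdjacent v)
      ≡⟨ cong (λ s → s + inDegreeWithin T v + outDegreeWithin T v + count (nonAdjacent v)) (count-≟ v) ⟩
    1 + inDegreeWithin T v + outDegreeWithin T v + count (nonAdjacent v) ∎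
    where
    open ≤-Reasoning
    e i o : Fin n → ℕ
    e u = toℕ (does (u ≟ v))
    i u = toℕ (T u ∧ E u v)
    o u = toℕ (T u ∧ E v u)
    covered : ∀ t eq x y → toℕ t ≤ toℕ eq + toℕ (t ∧ x) + toℕ (t ∧ y) + toℕ (not eq ∧ (not y ∧ not x))
    covered false eq    x     y     = z≤n
    covered true  true  x     y     = s≤s z≤n
    covered true  false true  y     = s≤s z≤n
    covered true  false false true  = s≤s z≤n
    covered true  false false false = s≤s z≤n

  ∑-outDegreeWithin≡∑-inDegreeWithin : ∀ T →
    ∑[ v < n ] (toℕ (T v) * outDegreeWithin T v) ≡ ∑[ v < n ] (toℕ (T v) * inDegreeWithin T v)
  ∑-outDegreeWithin≡∑-inDegreeWithin T = begin
    ∑[ v < n ] (toℕ (T v) * outDegreeWithin T v)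
      ≡⟨ sum-cong-≗ (λ v → *-distribˡ-sum (toℕ (T v)) (λ u → toℕ (T u ∧ E v u))) ⟩
    ∑[ v < n ] ∑[ u < n ] (toℕ (T v) * toℕ (T u ∧ E v u))
      ≡⟨ sum-cong-≗ (λ v → sum-cong-≗ (λ u → swap (T v) (T u) (E v u))) ⟩
    ∑[ v < n ] ∑[ u < n ] (toℕ (T u) * toℕ (T v ∧ E v u))
      ≡⟨ ∑-comm (λ v u → toℕ (T u) * toℕ (T v ∧ E v u)) ⟩
    ∑[ u < n ] ∑[ v < n ] (toℕ (T u) * toℕ (T v ∧ E v u))
      ≡⟨ sum-cong-≗ (λ u → *-distribˡ-sum (toℕ (T u)) (λ v → toℕ (T v ∧ E v u))) ⟨
    ∑[ u < n ] (toℕ (T u) * inDegreeWithin T u) ∎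
    where
    open ≡-Reasoning
    swap : ∀ a b x → toℕ a * toℕ (b ∧ x) ≡ toℕ b * toℕ (a ∧ x)
    swap false false x = refl
    swap false true  x = refl
    swap true  false x = refl
    swap true  true  x = refl

  module _ (d : ℕ) (nonAdjacent≤d : ∀ v → count (nonAdjacent v) ≤ d) where

    ∃-highInDegreeWithin : ∀ T → 1 ≤ count T → ∃[ v ] T v ≡ true × count T ≤ 1 + 2 * inDegreeWithin T v + d
    ∃-highInDegreeWithin T 1≤|T| =
      let v , Tv , |T|<bound = ∑-weighted<⇒∃< T ∑|T|<∑bound in v , Tv , s≤s⁻¹ |T|<bound
      where
      open ≤-Reasoning
      [_] : Fin n → ℕ
      [ v ] = toℕ (T v)
      in′ out′ : Fin n → ℕ
      in′  = inDegreeWithin T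
      out′ = outDegreeWithin T
      ∑|T|<∑bound : ∑[ v < n ] ([ v ] * count T) < ∑[ v < n ] ([ v ] * (2 + 2 * in′ v + d))
      ∑|T|<∑bound = begin-strict
        ∑[ v < n ] ([ v ] * count T)
          ≤⟨ ∑-mono-≤ (λ v → *-monoʳ-≤ [ v ] (≤-trans (count≤1+in+out+nonAdjacent T v)
                                                       (+-monoʳ-≤ _ (nonAdjacent≤d v)))) ⟩
        ∑[ v < n ] ([ v ] * (1 + in′ v + out′ v + d))
          ≡⟨ sum-cong-≗ (λ v → split [ v ] (in′ v) (out′ v) d) ⟩
        ∑[ v < n ] ([ v ] * (1 + in′ v + d) + [ v ] * out′ v)
          ≡⟨ ∑-distrib-+ (λ v → [ v ] * (1 + in′ v + d)) _ ⟩
        ∑[ v < n ] ([ v ] * (1 + in′ v + d)) + ∑[ v < n ] ([ v ] * out′ v)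
          ≡⟨ cong (∑[ v < n ] ([ v ] * (1 + in′ v + d)) +_) (∑-outDegreeWithin≡∑-inDegreeWithin T) ⟩
        ∑[ v < n ] ([ v ] * (1 + in′ v + d)) + ∑[ v < n ] ([ v ] * in′ v)
          ≡⟨ ∑-distrib-+ (λ v → [ v ] * (1 + in′ v + d)) _ ⟨
        ∑[ v < n ] ([ v ] * (1 + in′ v + d) + [ v ] * in′ v)
          ≡⟨ sum-cong-≗ (λ v → merge [ v ] (in′ v) d) ⟩
        ∑[ v < n ] ([ v ] * (1 + 2 * in′ v + d))
          <⟨ m<m+n _ 1≤|T| ⟩
        ∑[ v < n ] ([ v ] * (1 + 2 * in′ v + d)) + count T
          ≡⟨ ∑-distrib-+ (λ v → [ v ] * (1 + 2 * in′ v + d)) [_] ⟨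
        ∑[ v < n ] ([ v ] * (1 + 2 * in′ v + d) + [ v ])
          ≡⟨ sum-cong-≗ (λ v → step [ v ] (in′ v) d) ⟩
        ∑[ v < n ] ([ v ] * (2 + 2 * in′ v + d)) ∎
        where
        split : ∀ t a b d → t * (1 + a + b + d) ≡ t * (1 + a + d) + t * b
        split = solve-∀
        merge : ∀ t a d → t * (1 + a + d) + t * a ≡ t * (1 + 2 * a + d)
        merge = solve-∀
        step : ∀ t a d → t * (1 + 2 * a + d) + t ≡ t * (2 + 2 * a + d)
        step = solve-∀

    record Greedy (j : ℕ) : Set where
      field
        chosen           : Fin j → Fin n
        chosen-injective : Injective _≡_ _≡_ chosen
        chosen-inDegree  : ∀ i → n ≤ 2 * inDegree (chosen i) + j + d
        remaining        : Fin n → Bool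
        chosen-removed   : ∀ i → remaining (chosen i) ≡ false
        count-remaining  : count remaining + j ≡ n

    greedy-start : Greedy 0
    greedy-start = record
      { chosen           = λ ()
      ; chosen-injective = λ {}
      ; chosen-inDegree  = λ ()
      ; remaining        = λ _ → true
      ; chosen-removed   = λ ()
      ; count-remaining  = trans (+-identityʳ _) (count-all n)
      }

    module _ {j} (G : Greedy j) where
      open Greedy G

      remaining-nonempty : j < n → 1 ≤ count remaining
      remaining-nonempty j<n with count remaining | count-remaining
      ... | zero  | j≡n = contradiction j≡n (<⇒≢ j<n)
      ... | suc _ | _   = s≤s z≤n

      pick : ∀ {v} → remaining v ≡ true → count remaining ≤ 1 + 2 * inDegreeWithin remaining v + d → Greedy (suc j)
      pick {v} Tv |T|≤ = record
        { chosen           = v ∷ chosen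
        ; chosen-injective = ∷-injective chosen-injective v∉chosen
        ; chosen-inDegree  = λ { zero → v-inDegree ; (suc i) → ≤-trans (chosen-inDegree i) (j≤1+j i) }
        ; remaining        = λ u → remaining u ∧ not (does (u ≟ v))
        ; chosen-removed   = λ { zero → v-removed ; (suc i) → cong (_∧ _) (chosen-removed i) }
        ; count-remaining  = trans (+-suc _ j) (trans (cong (_+ j) (sym (count-remove remaining Tv))) count-remaining)
        }
        where
        v∉chosen : ∀ i → chosen i ≢ v
        v∉chosen i cᵢ≡v with trans (sym Tv) (trans (cong remaining (sym cᵢ≡v)) (chosen-removed i))
        ... | ()
        v-removed : remaining v ∧ not (does (v ≟ v)) ≡ false
        v-removed rewrite dec-true (v ≟ v) refl = ∧-zeroʳ _
        j≤1+j : ∀ i → 2 * inDegree (chosen i) + j + d ≤ 2 * inDegree (chosen i) + suc j + d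
        j≤1+j i = +-monoˡ-≤ d (+-monoʳ-≤ _ (n≤1+n j))
        v-inDegree : n ≤ 2 * inDegree v + suc j + d
        v-inDegree = begin
          n                                          ≡⟨ count-remaining ⟨
          count remaining + j                        ≤⟨ +-monoˡ-≤ j |T|≤ ⟩
          1 + 2 * inDegreeWithin remaining v + d + j ≤⟨ +-monoˡ-≤ j (+-monoˡ-≤ d (s≤s (*-monoʳ-≤ 2 (inDegreeWithin≤inDegree remaining v)))) ⟩
          1 + 2 * inDegree v + d + j                 ≡⟨ shuffle (2 * inDegree v) d j ⟩
          2 * inDegree v + suc j + d                 ∎
          where
          open ≤-Reasoning
          shuffle : ∀ a d j → 1 + a + d + j ≡ a + suc j + d
          shuffle = solve-∀

    greedy : ∀ j → j ≤ n → Greedy j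
    greedy zero    _   = greedy-start
    greedy (suc j) j<n =
      let G = greedy j (<⇒≤ j<n)
          v , Tv , |T|≤ = ∃-highInDegreeWithin (Greedy.remaining G) (remaining-nonempty G j<n)
      in pick G Tv |T|≤

    highInDegreeVertices : ∀ k → k ≤ n →
      Σ (Fin k → Fin n) λ f → Injective _≡_ _≡_ f × (∀ i → n ≤ 2 * inDegree (f i) + k + d)
    highInDegreeVertices k k≤n = chosen , chosen-injective , chosen-inDegree
      where open Greedy (greedy k k≤n)

module _ {n} (D : DiMultigraph n) where

  arcRel : Fin n → Fin n → Bool
  arcRel u v = does (arc? D u v)

  inDeg≡inDegree : ∀ v → inDeg D v ≡ inDegree arcRel v
  inDeg≡inDegree v = length-filter-tabulate (λ u → arc? D u v) (λ u → u)

  outDeg≡inDegree-flip : ∀ v → outDeg D v ≡ inDegree (flip arcRel) v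
  outDeg≡inDegree-flip v = length-filter-tabulate (λ w → arc? D v w) (λ w → w)

  nonDeg≡count-nonAdjacent : ∀ v → nonDeg D v ≡ count (nonAdjacent arcRel v)
  nonDeg≡count-nonAdjacent v = length-filter-tabulate _ {n} (λ w → w)

  nonDeg≡count-nonAdjacent-flip : ∀ v → nonDeg D v ≡ count (nonAdjacent (flip arcRel) v)
  nonDeg≡count-nonAdjacent-flip v = trans (nonDeg≡count-nonAdjacent v)
    (sum-cong-≗ λ u → cong (λ b → toℕ (not (does (u ≟ v)) ∧ b)) (∧-comm (not (arcRel v u)) (not (arcRel u v))))

lemma2p2 : (k n d : ℕ) → 1 ≤ k → 2 ≤ n → k ≤ n → (D : DiMultigraph n) → MaxNonDegAtMost D d →
    (Σ (Fin k → Fin n) λ f → Injective _≡_ _≡_ f × ((i : Fin k) → n ≤ 2 * inDeg D (f i) + k + d))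
    × (Σ (Fin k → Fin n) λ f → Injective _≡_ _≡_ f × ((i : Fin k) → n ≤ 2 * outDeg D (f i) + k + d))
lemma2p2 k n d _ _ k≤n D Δ̄≤d =
    transfer (inDeg≡inDegree D) (highInDegreeVertices (arcRel D) d
      (λ v → subst (_≤ d) (nonDeg≡count-nonAdjacent D v) (Δ̄≤d v)) k k≤n)
  , transfer (outDeg≡inDegree-flip D) (highInDegreeVertices (flip (arcRel D)) d
      (λ v → subst (_≤ d) (nonDeg≡count-nonAdjacent-flip D v) (Δ̄≤d v)) k k≤n)
  where
  transfer : ∀ {deg deg′ : Fin n → ℕ} → (∀ v → deg v ≡ deg′ v) →
    Σ (Fin k → Fin n) (λ f → Injective _≡_ _≡_ f × (∀ i → n ≤ 2 * deg′ (f i) + k + d)) →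
    Σ (Fin k → Fin n) (λ f → Injective _≡_ _≡_ f × (∀ i → n ≤ 2 * deg (f i) + k + d))
  transfer deg≡ (f , f-inj , f-high) = f , f-inj , λ i → subst (λ x → n ≤ 2 * x + k + d) (sym (deg≡ (f i))) (f-high i)
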